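{- Let $G$ be a group with symmetric generating set $B$, and let $Z$ be a normal subgroup of $G$. Suppose that $B\cap Z$ is not a normal subgroup of $G$. Then $(B^3\cap Z)\setminus B\neq\varnothing$.
   Context: $B^3$ denotes the set of all products of three elements of $B$. -}

module Defs where

open import Level using (_⊔_)
open import Algebra.Bundles using (Group)
open import Relation.Unary using (Pred)
open import Data.Product using (Σ; _×_)

module _ {c ℓ} (G : Group c ℓ) where
  open Group G

  RespectsEq : ∀ {p} → Pred Carrier p → Set (c ⊔ ℓ ⊔ p)
  RespectsEq P = ∀ {x y} → x ≈ y → P x → P y

  data Generated {p} (B : Pred Carrier p) : Pred Carrier (c ⊔ ℓ ⊔ p) where
    gen    : ∀ {x} → B x → Generated B x
    gen-ε  : Generated B ε
    gen-∙  : ∀ {x y} → Generated B x → Generated B y → Generated B (x ∙ y)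
    gen-⁻¹ : ∀ {x} → Generated B x → Generated B (x ⁻¹)
    gen-≈  : ∀ {x y} → x ≈ y → Generated B x → Generated B y

  Generates : ∀ {p} → Pred Carrier p → Set (c ⊔ ℓ ⊔ p)
  Generates B = ∀ x → Generated B x

  Symmetric : ∀ {p} → Pred Carrier p → Set (c ⊔ p)
  Symmetric B = ∀ {x} → B x → B (x ⁻¹)

  record IsNormalSubgroup {p} (Z : Pred Carrier p) : Set (c ⊔ ℓ ⊔ p) where
    field
      resp     : RespectsEq Z
      ε-mem    : Z ε
      ∙-closed : ∀ {x y} → Z x → Z y → Z (x ∙ y)
      ⁻¹-closed : ∀ {x} → Z x → Z (x ⁻¹)
      conj     : ∀ g {z} → Z z → Z (g ∙ z ∙ g ⁻¹)

  Cube : ∀ {p} → Pred Carrier p → Pred Carrier (c ⊔ ℓ ⊔ p)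
  Cube B x = Σ Carrier λ a → Σ Carrier λ b → Σ Carrier λ d →
             B a × B b × B d × (x ≈ a ∙ b ∙ d)

{-# OPTIONS --safe #-}
-- If B³ ∩ Z ⊆ B, then B ∩ Z is closed under products (x y = x y ε ∈ B³) and
-- under conjugation by each b ∈ B (b z b⁻¹ ∈ B³, and Z is normal).  The elements
-- g for which both g and g⁻¹ normalize B ∩ Z form a subgroup; as B is symmetric
-- it contains B, hence all of G = ⟨B⟩.  So B ∩ Z would be a normal subgroup.
module Submission where

open import Defs
open import Algebra.Bundles using (Group)
open import Relation.Unary using (Pred; _∈_; _∩_; _⊆_)
open import Relation.Nullary using (¬_)
open import Data.Product using (_,_; _×_; proj₁)
open import Level using (_⊔_)
import Algebra.Properties.Group as GroupProperties
import Relation.Binary.Reasoning.Setoid as SetoidReasoning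

module _ {c ℓ} (G : Group c ℓ) where
  open Group G
  open GroupProperties G
  open SetoidReasoning setoid

  ∩-respects : ∀ {p q} {P : Pred Carrier p} {Q : Pred Carrier q} →
    RespectsEq G P → RespectsEq G Q → RespectsEq G (P ∩ Q)
  ∩-respects respP respQ x≈y (Px , Qx) = respP x≈y Px , respQ x≈y Qx

  generated-minimal : ∀ {p q} {B : Pred Carrier p} (H : Pred Carrier q) →
    RespectsEq G H → B ⊆ H → H ε →
    (∀ {x y} → H x → H y → H (x ∙ y)) → (∀ {x} → H x → H (x ⁻¹)) →
    Generated G B ⊆ H
  generated-minimal H respH B⊆H Hε H∙ H⁻¹ = go
    where
    go : Generated G _ ⊆ H
    go (gen b)     = B⊆H b
    go gen-ε       = Hε
    go (gen-∙ x y) = H∙ (go x) (go y)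
    go (gen-⁻¹ x)  = H⁻¹ (go x)
    go (gen-≈ e x) = respH e (go x)

  Normalizes : ∀ {p} → Pred Carrier p → Pred Carrier (c ⊔ p)
  Normalizes S g = ∀ {z} → S z → S (g ∙ z ∙ g ⁻¹)

  module _ {p} {S : Pred Carrier p} (respS : RespectsEq G S) where

    normalizes-resp : RespectsEq G (Normalizes S)
    normalizes-resp x≈y nx Sz = respS (∙-cong (∙-cong x≈y refl) (⁻¹-cong x≈y)) (nx Sz)

    normalizes-ε : Normalizes S ε
    normalizes-ε {z} = respS (begin
      z             ≈⟨ identityˡ z ⟨
      ε ∙ z         ≈⟨ identityʳ (ε ∙ z) ⟨
      ε ∙ z ∙ ε     ≈⟨ ∙-congˡ ε⁻¹≈ε ⟨
      ε ∙ z ∙ ε ⁻¹  ∎)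

    normalizes-∙ : ∀ {x y} → Normalizes S x → Normalizes S y → Normalizes S (x ∙ y)
    normalizes-∙ {x} {y} nx ny {z} Sz = respS (begin
      x ∙ (y ∙ z ∙ y ⁻¹) ∙ x ⁻¹     ≈⟨ ∙-congʳ (assoc x (y ∙ z) (y ⁻¹)) ⟨
      x ∙ (y ∙ z) ∙ y ⁻¹ ∙ x ⁻¹     ≈⟨ assoc (x ∙ (y ∙ z)) (y ⁻¹) (x ⁻¹) ⟩
      x ∙ (y ∙ z) ∙ (y ⁻¹ ∙ x ⁻¹)   ≈⟨ ∙-cong (assoc x y z) (⁻¹-anti-homo-∙ x y) ⟨
      x ∙ y ∙ z ∙ (x ∙ y) ⁻¹        ∎) (nx (ny Sz))

    -- Normalizing is not closed under inverses for a mere set S, so the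
    -- induction carries g and g⁻¹ together.
    generated-normalizes : ∀ {q} {B : Pred Carrier q} →
      (∀ {b} → B b → Normalizes S b × Normalizes S (b ⁻¹)) →
      Generated G B ⊆ Normalizes S
    generated-normalizes nB Gg =
      proj₁ (generated-minimal NormalizesBoth respBoth nB bothε both∙ both⁻¹ Gg)
      where
      NormalizesBoth : Pred Carrier (c ⊔ p)
      NormalizesBoth g = Normalizes S g × Normalizes S (g ⁻¹)

      respBoth : RespectsEq G NormalizesBoth
      respBoth x≈y (nx , nx⁻¹) = normalizes-resp x≈y nx , normalizes-resp (⁻¹-cong x≈y) nx⁻¹

      bothε : NormalizesBoth ε
      bothε = normalizes-ε , normalizes-resp (sym ε⁻¹≈ε) normalizes-ε

      both∙ : ∀ {x y} → NormalizesBoth x → NormalizesBoth y → NormalizesBoth (x ∙ y)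
      both∙ {x} {y} (nx , nx⁻¹) (ny , ny⁻¹) =
        normalizes-∙ nx ny , normalizes-resp (sym (⁻¹-anti-homo-∙ x y)) (normalizes-∙ ny⁻¹ nx⁻¹)

      both⁻¹ : ∀ {x} → NormalizesBoth x → NormalizesBoth (x ⁻¹)
      both⁻¹ (nx , nx⁻¹) = nx⁻¹ , normalizes-resp (sym (⁻¹-involutive _)) nx

  cube-closed⇒normal : ∀ {p} {B Z : Pred Carrier p} →
    RespectsEq G B → Symmetric G B → ε ∈ B → Generates G B →
    IsNormalSubgroup G Z →
    (∀ x → x ∈ Cube G B → x ∈ Z → x ∈ B) →
    IsNormalSubgroup G (B ∩ Z)
  cube-closed⇒normal {B = B} {Z} respB symB εB genB normalZ cube∩Z⊆B = record
    { resp      = respB∩Z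
    ; ε-mem     = εB , Z.ε-mem
    ; ∙-closed  = λ { {x} {y} (Bx , Zx) (By , Zy) →
        let Zxy = Z.∙-closed Zx Zy
        in cube∩Z⊆B _ (x , y , ε , Bx , By , εB , sym (identityʳ _)) Zxy , Zxy }
    ; ⁻¹-closed = λ (Bx , Zx) → symB Bx , Z.⁻¹-closed Zx
    ; conj      = λ g → generated-normalizes respB∩Z
                          (λ Bb → B-normalizes Bb , B-normalizes (symB Bb)) (genB g)
    }
    where
    module Z = IsNormalSubgroup normalZ

    respB∩Z : RespectsEq G (B ∩ Z)
    respB∩Z = ∩-respects respB Z.resp

    B-normalizes : ∀ {b} → B b → Normalizes (B ∩ Z) b
    B-normalizes {b} Bb {z} (Bz , Zz) =
      cube∩Z⊆B _ (b , z , b ⁻¹ , Bb , Bz , symB Bb , refl) (Z.conj b Zz) , Z.conj b Zz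

lemma3p2 : ∀ {c ℓ p} (G : Group c ℓ) (B Z : Pred (Group.Carrier G) p) →
    RespectsEq G B → Symmetric G B → Group.ε G ∈ B → Generates G B →
    IsNormalSubgroup G Z →
    ¬ IsNormalSubgroup G (B ∩ Z) →
    ¬ (∀ x → x ∈ Cube G B → x ∈ Z → x ∈ B)
lemma3p2 G B Z respB symB εB genB normalZ notNormal cube∩Z⊆B =
  notNormal (cube-closed⇒normal G respB symB εB genB normalZ cube∩Z⊆B)
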